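{- Let $\phi$ be a proper partial $r$-edge-coloring of a loopless multigraph $G$, let $\alpha,\beta\in[r]$, let $F=(e_0,\dots,e_{k-1})$ be a $\phi$-shiftable fan, and set $x \coloneqq \mathsf{Pivot}(F)$, $y\coloneqq \mathsf{vEnd}(F)$. Define $\psi \coloneqq \mathsf{Shift}(\phi,F)$ and $I \coloneqq \{0\le i<k-1 : e_i\in E_G(x,y)\}$. If $F$ is $(\phi,\alpha\beta)$-hopeful (respectively, $(\phi,\alpha\beta)$-successful) and $\phi(e_{i+1})\notin\{\alpha,\beta\}$ for each $i\in I$, then the edge $\mathsf{End}(F)$ is $(\psi,\alpha\beta)$-hopeful (respectively, $(\psi,\alpha\beta)$-successful).
   Context: $G$ is a finite loopless multigraph; $E_G(x)$ is the set of edges at $x$, $E_G(x,y)$ the set of edges between $x$ and $y$, $V(e)$ the set of endpoints of $e$. A partial $r$-edge-coloring is a map $\phi:E(G)\to[r]\cup\{\mathsf{blank}\}$ ($[r]=\{1,\dots,r\}$; edges mapped to $\mathsf{blank}$ are uncolored); it is proper if any two distinct colored edges sharing an endpoint receive distinct colors. $M(\phi,x)\coloneqq[r]\setminus\{\phi(e): e\in E_G(x)\}$ is the set of colors missing at $x$. An uncolored edge with endpoints $x,y$ is $\phi$-happy if $M(\phi,x)\cap M(\phi,y)\neq\varnothing$. A chain is a sequence $C=(e_0,\dots,e_{k-1})$ of distinct edges with $|V(e_i)\cap V(e_{i+1})|=1$ for all $i$; $\mathsf{Start}(C)=e_0$, $\mathsf{End}(C)=e_{k-1}$. $\mathsf{Shift}(\phi,C)$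 is the coloring that gives $e_i$ the color $\phi(e_{i+1})$ for $0\le i<k-1$, makes $e_{k-1}$ uncolored, and agrees with $\phi$ elsewhere. $C$ is $\phi$-shiftable if $\phi(e_0)=\mathsf{blank}$ and $\mathsf{Shift}(\phi,C)$ is proper; $C$ is $\phi$-happy if it is $\phi$-shiftable and $\mathsf{End}(C)$ is $\mathsf{Shift}(\phi,C)$-happy. For colors $\alpha,\beta$, $G(\phi,\alpha\beta)$ is the spanning subgraph of edges colored $\alpha$ or $\beta$ under $\phi$, $\deg(v;\phi,\alpha\beta)$ is the degree of $v$ in it, and $u,v$ are $(\phi,\alpha\beta)$-related if they lie in the same connected component of $G(\phi,\alpha\beta)$. An uncolored edge $e\in E_G(u,v)$ is $(\phi,\alpha\beta)$-hopeful if $\deg(u;\phi,\alpha\beta)<2$ and $\deg(v;\phi,\alpha\beta)<2$, and $(\phi,\alpha\beta)$-successful if moreover $u,v$ are not $(\phi,\alpha\beta)$-related. A fan is a chain $F=(e_0,\dots,e_{k-1})$ all of whose edges contain a common vertex $x=\mathsf{Pivot}(F)$; letting $y_i$ be the endpoint of $e_i$ other than $x$ (the $y_i$ need not be distinct), $\mathsf{vStart}(F)=y_0$ and $\mathsf{vEnd}(F)=y_{k-1}$. For a $\phi$-shiftable fan $F$ that is not $\phi$-happy, with $x=\mathsf{Pivot}(F)$, $y=\mathsf{vEnd}(F)$: $F$ is $(\phi,\alpha\beta)$-hopeful if $\deg(x;\phi,\alpha\beta)<2$ and $\deg(y;\phi,\alpha\beta)<2$, and $(\phi,\alpha\beta)$-successful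 if it is $(\phi,\alpha\beta)$-hopeful and $x,y$ are not $(\mathsf{Shift}(\phi,F),\alpha\beta)$-related. -}

module Defs where

open import Data.Nat using (ℕ; zero; suc; _<_)
open import Data.Fin using (Fin; zero; suc; inject₁; _≟_)
open import Data.Fin.Subset using (Subset; ⁅_⁆; _∪_; _∩_; ∣_∣)
open import Data.Maybe using (Maybe; just; nothing)
open import Data.Maybe.Properties using (≡-dec)
open import Data.Product using (_×_; _,_; proj₁; proj₂; ∃; ∃-syntax; Σ)
open import Data.Sum using (_⊎_)
open import Data.List using (List; length; filter)
open import Data.List.Base using (allFin)
open import Data.Vec using (Vec; _∷_; []; lookup; last)
open import Relation.Nullary using (¬_; Dec; yes; no)
open import Relation.Nullary.Decidable using (_⊎-dec_; _×-dec_)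
open import Relation.Binary.PropositionalEquality using (_≡_; _≢_)
open import Relation.Binary.Construct.Closure.ReflexiveTransitive using (Star)

record Multigraph : Set where
  field
    n        : ℕ
    m        : ℕ
    ends     : Fin m → Fin n × Fin n
    loopless : ∀ e → proj₁ (ends e) ≢ proj₂ (ends e)

module _ (G : Multigraph) where
  open Multigraph G

  Vertex : Set
  Vertex = Fin n

  Edge : Set
  Edge = Fin m

  V : Edge → Subset n
  V e = ⁅ proj₁ (ends e) ⁆ ∪ ⁅ proj₂ (ends e) ⁆

  _∈V_ : Vertex → Edge → Set
  x ∈V e = (x ≡ proj₁ (ends e)) ⊎ (x ≡ proj₂ (ends e))

  _∈V?_ : ∀ x e → Dec (x ∈V e)
  x ∈V? e = (x ≟ proj₁ (ends e)) ⊎-dec (x ≟ proj₂ (ends e))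

  InE : Edge → Vertex → Vertex → Set
  InE e x y = (ends e ≡ (x , y)) ⊎ (ends e ≡ (y , x))

  -- Partial r-edge-colorings: just c is the color c (Fin r ≅ [r]), nothing is blank.
  Coloring : ℕ → Set
  Coloring r = Edge → Maybe (Fin r)

  Proper : ∀ {r} → Coloring r → Set
  Proper φ = ∀ e f x → e ≢ f → x ∈V e → x ∈V f → ∀ c → φ e ≡ just c → φ f ≢ just c

  Missing : ∀ {r} → Coloring r → Vertex → Fin r → Set
  Missing φ x c = ∀ e → x ∈V e → φ e ≢ just c

  HappyEdge : ∀ {r} → Coloring r → Edge → Set
  HappyEdge φ e = (φ e ≡ nothing) ×
    (∃[ c ] (Missing φ (proj₁ (ends e)) c × Missing φ (proj₂ (ends e)) c))

  IsChain : ∀ {k} → Vec Edge (suc k) → Set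
  IsChain {k} C = (∀ i j → lookup C i ≡ lookup C j → i ≡ j) ×
    (∀ (i : Fin k) → ∣ V (lookup C (inject₁ i)) ∩ V (lookup C (suc i)) ∣ ≡ 1)

  Start End : ∀ {k} → Vec Edge (suc k) → Edge
  Start C = lookup C zero
  End C = last C

  Shift : ∀ {r k} → Coloring r → Vec Edge (suc k) → Coloring r
  Shift φ (e ∷ []) f with f ≟ e
  ... | yes _ = nothing
  ... | no _ = φ f
  Shift φ (e ∷ e' ∷ es) f with f ≟ e
  ... | yes _ = φ e'
  ... | no _ = Shift φ (e' ∷ es) f

  Shiftable : ∀ {r k} → Coloring r → Vec Edge (suc k) → Set
  Shiftable φ C = (φ (Start C) ≡ nothing) × Proper (Shift φ C)

  HappyChain : ∀ {r k} → Coloring r → Vec Edge (suc k) → Set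
  HappyChain φ C = Shiftable φ C × HappyEdge (Shift φ C) (End C)

  IsFan : ∀ {k} → Vec Edge (suc k) → Vertex → Vertex → Set
  IsFan F x y = IsChain F × (∀ i → x ∈V lookup F i) × InE (End F) x y

  InAB : ∀ {r} → Coloring r → Fin r → Fin r → Edge → Set
  InAB φ α β e = (φ e ≡ just α) ⊎ (φ e ≡ just β)

  InAB? : ∀ {r} (φ : Coloring r) α β e → Dec (InAB φ α β e)
  InAB? φ α β e = ≡-dec _≟_ (φ e) (just α) ⊎-dec ≡-dec _≟_ (φ e) (just β)

  deg : ∀ {r} → Vertex → Coloring r → Fin r → Fin r → ℕ
  deg v φ α β = length (filter (λ e → (v ∈V? e) ×-dec InAB? φ α β e) (allFin m))

  AdjAB : ∀ {r} → Coloring r → Fin r → Fin r → Vertex → Vertex → Set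
  AdjAB φ α β u v = ∃[ e ] (InAB φ α β e × InE e u v)

  Related : ∀ {r} → Coloring r → Fin r → Fin r → Vertex → Vertex → Set
  Related φ α β = Star (AdjAB φ α β)

  HopefulEdge : ∀ {r} → Coloring r → Fin r → Fin r → Edge → Set
  HopefulEdge φ α β e = (φ e ≡ nothing) ×
    (deg (proj₁ (ends e)) φ α β < 2) × (deg (proj₂ (ends e)) φ α β < 2)

  SuccessfulEdge : ∀ {r} → Coloring r → Fin r → Fin r → Edge → Set
  SuccessfulEdge φ α β e = HopefulEdge φ α β e ×
    ¬ Related φ α β (proj₁ (ends e)) (proj₂ (ends e))

  HopefulFan : ∀ {r k} → Coloring r → Fin r → Fin r →
               Vec Edge (suc k) → Vertex → Vertex → Set
  HopefulFan φ α β F x y = Shiftable φ F × ¬ HappyChain φ F ×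
    (deg x φ α β < 2) × (deg y φ α β < 2)

  SuccessfulFan : ∀ {r k} → Coloring r → Fin r → Fin r →
                  Vec Edge (suc k) → Vertex → Vertex → Set
  SuccessfulFan φ α β F x y = HopefulFan φ α β F x y ×
    ¬ Related (Shift φ F) α β x y

module Submission where

-- Shifting a fan only moves colours along its edges, all of which contain the pivot x,
-- so every colour seen at x after the shift was already seen at x before. At y = vEnd
-- the only edges whose colour changes are fan edges joining x and y, and by hypothesis
-- they receive no colour in {α, β}. Since the shifted colouring is proper, each of x, y
-- carries at most one αβ-edge afterwards, because two would need two distinct αβ-colours,
-- hence two αβ-edges, already before. The uncoloured edge End F joins x and y, so
-- hopefulness transfers, and unrelatedness of x, y is exactly the successful case.

open import Defs
open import Data.Nat using (ℕ; suc; _<_; s≤s; z≤n)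
open import Data.Fin using (Fin; zero; suc; inject₁; fromℕ; _≟_)
open import Data.Fin.Properties using (suc-injective)
open import Data.Maybe using (just; nothing)
open import Data.Product using (_×_; _,_; proj₁; proj₂; ∃-syntax; swap)
open import Data.Sum using (_⊎_; inj₁; inj₂)
open import Data.Vec using (Vec; lookup; _∷_; []; last)
open import Data.List using (List; filter; length; allFin) renaming (_∷_ to _∷ₗ_; [] to []ₗ)
open import Data.List.Membership.Propositional using (_∈_)
open import Data.List.Membership.Propositional.Properties using (∈-filter⁺; ∈-filter⁻; ∈-allFin)
open import Data.List.Relation.Unary.Any using (here; there)
open import Data.List.Relation.Unary.All using (_∷_)
open import Data.List.Relation.Unary.AllPairs using (_∷_)
open import Data.List.Relation.Unary.Unique.Propositional using (Unique)
open import Data.List.Relation.Unary.Unique.Propositional.Properties using (allFin⁺; filter⁺)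
open import Data.Empty using (⊥-elim)
open import Function using (_∘_)
open import Level using (Level)
open import Relation.Nullary using (¬_; yes; no)
open import Relation.Unary using (Pred; Decidable)
open import Relation.Binary using (Rel; Symmetric)
open import Relation.Binary.PropositionalEquality using (_≡_; _≢_; refl; sym; trans; cong; subst)
open import Relation.Binary.Construct.Closure.ReflexiveTransitive using (reverse)

module _ {a : Level} {A : Set a} where

  length<2⇒∈-≡ : ∀ {xs : List A} {x y} → length xs < 2 → x ∈ xs → y ∈ xs → x ≡ y
  length<2⇒∈-≡ {_ ∷ₗ []ₗ} _ (here refl) (here refl) = refl
  length<2⇒∈-≡ {_ ∷ₗ _ ∷ₗ _} (s≤s (s≤s ())) _ _

  unique-∈-≡⇒length<2 : ∀ {xs : List A} → Unique xs → (∀ {x y} → x ∈ xs → y ∈ xs → x ≡ y) →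
                        length xs < 2
  unique-∈-≡⇒length<2 {[]ₗ} _ _ = s≤s z≤n
  unique-∈-≡⇒length<2 {_ ∷ₗ []ₗ} _ _ = s≤s (s≤s z≤n)
  unique-∈-≡⇒length<2 {_ ∷ₗ _ ∷ₗ _} ((x≢y ∷ _) ∷ _) ∈-≡ =
    ⊥-elim (x≢y (∈-≡ (here refl) (there (here refl))))

  module _ {p : Level} {P : Pred A p} (P? : Decidable P) where

    length-filter<2⇒≡ : ∀ {xs x y} → length (filter P? xs) < 2 →
                        x ∈ xs → y ∈ xs → P x → P y → x ≡ y
    length-filter<2⇒≡ len x∈ y∈ px py = length<2⇒∈-≡ len (∈-filter⁺ P? x∈ px) (∈-filter⁺ P? y∈ py)

    unique-≡⇒length-filter<2 : ∀ {xs} → Unique xs → (∀ {x y} → P x → P y → x ≡ y) →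
                               length (filter P? xs) < 2
    unique-≡⇒length-filter<2 {xs} u ≡-on-P = unique-∈-≡⇒length<2 (filter⁺ P? u)
      λ x∈ y∈ → ≡-on-P (proj₂ (∈-filter⁻ P? {xs = xs} x∈)) (proj₂ (∈-filter⁻ P? {xs = xs} y∈))

module _ (G : Multigraph) where
  open Multigraph G

  InE⇒≢ : ∀ {e x y} → InE G e x y → x ≢ y
  InE⇒≢ {e} (inj₁ refl) x≡y = loopless e x≡y
  InE⇒≢ {e} (inj₂ refl) x≡y = loopless e (sym x≡y)

  ∈V-both⇒InE : ∀ {f x y} → _∈V_ G x f → _∈V_ G y f → x ≢ y → InE G f x y
  ∈V-both⇒InE (inj₁ refl) (inj₂ refl) _ = inj₁ refl
  ∈V-both⇒InE (inj₂ refl) (inj₁ refl) _ = inj₂ refl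
  ∈V-both⇒InE (inj₁ refl) (inj₁ refl) x≢y = ⊥-elim (x≢y refl)
  ∈V-both⇒InE (inj₂ refl) (inj₂ refl) x≢y = ⊥-elim (x≢y refl)

  InE-ends : ∀ {ℓ} {R : Rel (Vertex G) ℓ} → Symmetric R → ∀ {e x y} → InE G e x y →
             R x y → R (proj₁ (ends e)) (proj₂ (ends e))
  InE-ends {R = R} _ (inj₁ p) rxy = subst (λ (u , v) → R u v) (sym p) rxy
  InE-ends {R = R} sym-R (inj₂ p) rxy = subst (λ (u , v) → R u v) (sym p) (sym-R rxy)

  InE-ends⁻ : ∀ {ℓ} {R : Rel (Vertex G) ℓ} → Symmetric R → ∀ {e x y} → InE G e x y →
              R (proj₁ (ends e)) (proj₂ (ends e)) → R x y
  InE-ends⁻ {R = R} _ (inj₁ p) r = subst (λ (u , v) → R u v) p r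
  InE-ends⁻ {R = R} sym-R (inj₂ p) r = sym-R (subst (λ (u , v) → R u v) p r)

  related-sym : ∀ {r} (φ : Coloring G r) {α β} → Symmetric (Related G φ α β)
  related-sym φ = reverse λ { (e , ab , inj₁ p) → e , ab , inj₂ p
                            ; (e , ab , inj₂ p) → e , ab , inj₁ p }

  AtMostOneAB : ∀ {r} → Coloring G r → Fin r → Fin r → Vertex G → Set
  AtMostOneAB φ α β v =
    ∀ {e f} → _∈V_ G v e → _∈V_ G v f → InAB G φ α β e → InAB G φ α β f → e ≡ f

  module _ {r} {φ : Coloring G r} {α β : Fin r} {v : Vertex G} where

    deg<2⇒atMostOneAB : deg G v φ α β < 2 → AtMostOneAB φ α β v
    deg<2⇒atMostOneAB deg<2 ve vf abe abf =
      length-filter<2⇒≡ _ deg<2 (∈-allFin _) (∈-allFin _) (ve , abe) (vf , abf)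

    atMostOneAB⇒deg<2 : AtMostOneAB φ α β v → deg G v φ α β < 2
    atMostOneAB⇒deg<2 atMostOne = unique-≡⇒length-filter<2 _ (allFin⁺ m)
      λ (ve , abe) (vf , abf) → atMostOne ve vf abe abf

  InheritsABColoursAt : ∀ {r} → Coloring G r → Coloring G r → Fin r → Fin r → Vertex G → Set
  InheritsABColoursAt ψ φ α β v =
    ∀ {f} → _∈V_ G v f → InAB G ψ α β f → ∃[ g ] (_∈V_ G v g × φ g ≡ ψ f)

  InAB⇒coloured : ∀ {r} (φ : Coloring G r) {α β e} → InAB G φ α β e → ∃[ c ] (φ e ≡ just c)
  InAB⇒coloured _ (inj₁ p) = _ , p
  InAB⇒coloured _ (inj₂ p) = _ , p

  InAB-transport : ∀ {r} (φ ψ : Coloring G r) {α β e f} → φ e ≡ ψ f →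
                   InAB G ψ α β f → InAB G φ α β e
  InAB-transport _ _ φe≡ψf (inj₁ p) = inj₁ (trans φe≡ψf p)
  InAB-transport _ _ φe≡ψf (inj₂ p) = inj₂ (trans φe≡ψf p)

  atMostOneAB-inherit : ∀ {r} {φ ψ : Coloring G r} {α β v} → Proper G ψ →
    InheritsABColoursAt ψ φ α β v → AtMostOneAB φ α β v → AtMostOneAB ψ α β v
  atMostOneAB-inherit {φ = φ} {ψ} ψ-proper inherits atMostOne {e} {f} ve vf abe abf with e ≟ f
  ... | yes e≡f = e≡f
  ... | no e≢f with inherits ve abe | inherits vf abf | InAB⇒coloured ψ abe
  ... | g , vg , φg≡ψe | h , vh , φh≡ψf | c , ψe≡c =
    ⊥-elim (ψ-proper e f _ e≢f ve vf c ψe≡c (trans (sym ψe≡ψf) ψe≡c))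
    where
      g≡h : g ≡ h
      g≡h = atMostOne vg vh (InAB-transport φ ψ φg≡ψe abe) (InAB-transport φ ψ φh≡ψf abf)

      ψe≡ψf : ψ e ≡ ψ f
      ψe≡ψf = trans (sym φg≡ψe) (trans (cong φ g≡h) φh≡ψf)

  deg<2-inherit : ∀ {r} {φ ψ : Coloring G r} {α β v} → Proper G ψ →
    InheritsABColoursAt ψ φ α β v → deg G v φ α β < 2 → deg G v ψ α β < 2
  deg<2-inherit ψ-proper inherits =
    atMostOneAB⇒deg<2 ∘ atMostOneAB-inherit ψ-proper inherits ∘ deg<2⇒atMostOneAB

  uncoloured⇒¬InAB : ∀ {r} (φ : Coloring G r) {α β e} → φ e ≡ nothing → ¬ InAB G φ α β e
  uncoloured⇒¬InAB _ φe≡nothing (inj₁ φe≡α) with trans (sym φe≡nothing) φe≡α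
  ... | ()
  uncoloured⇒¬InAB _ φe≡nothing (inj₂ φe≡β) with trans (sym φe≡nothing) φe≡β
  ... | ()

  module _ {r} (φ : Coloring G r) where

    shift-cases : ∀ {k} (C : Vec (Edge G) (suc k)) f →
      (Shift G φ C f ≡ φ f) ⊎ (Shift G φ C f ≡ nothing) ⊎
      (∃[ i ] (f ≡ lookup C (inject₁ i) × Shift G φ C f ≡ φ (lookup C (suc i))))
    shift-cases (e ∷ []) f with f ≟ e
    ... | yes _ = inj₂ (inj₁ refl)
    ... | no _ = inj₁ refl
    shift-cases (e ∷ e′ ∷ es) f with f ≟ e
    ... | yes f≡e = inj₂ (inj₂ (zero , f≡e , refl))
    ... | no _ with shift-cases (e′ ∷ es) f
    ...   | inj₁ unchanged = inj₁ unchanged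
    ...   | inj₂ (inj₁ uncoloured) = inj₂ (inj₁ uncoloured)
    ...   | inj₂ (inj₂ (i , f≡eᵢ , shifted)) = inj₂ (inj₂ (suc i , f≡eᵢ , shifted))

    last≡lookup-fromℕ : ∀ {k} (C : Vec (Edge G) (suc k)) → last C ≡ lookup C (fromℕ k)
    last≡lookup-fromℕ (e ∷ []) = refl
    last≡lookup-fromℕ (e ∷ e′ ∷ es) = last≡lookup-fromℕ (e′ ∷ es)

    shift-last : ∀ {k} (C : Vec (Edge G) (suc k)) →
                 (∀ i j → lookup C i ≡ lookup C j → i ≡ j) → Shift G φ C (last C) ≡ nothing
    shift-last (e ∷ []) _ with e ≟ e
    ... | yes _ = refl
    ... | no e≢e = ⊥-elim (e≢e refl)
    shift-last (e ∷ e′ ∷ es) distinct with last (e′ ∷ es) ≟ e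
    ... | yes last≡e
      with distinct (suc (fromℕ _)) zero (trans (sym (last≡lookup-fromℕ (e′ ∷ es))) last≡e)
    ...   | ()
    shift-last (e ∷ e′ ∷ es) distinct | no _ =
      shift-last (e′ ∷ es) (λ i j eq → suc-injective (distinct (suc i) (suc j) eq))

    module _ {k} (F : Vec (Edge G) (suc k)) {x : Vertex G} (pivot : ∀ i → _∈V_ G x (lookup F i))
             {α β : Fin r} where

      shift-inherits-at-pivot : InheritsABColoursAt (Shift G φ F) φ α β x
      shift-inherits-at-pivot {f} xf ab with shift-cases F f
      ... | inj₁ unchanged = f , xf , sym unchanged
      ... | inj₂ (inj₁ uncoloured) = ⊥-elim (uncoloured⇒¬InAB (Shift G φ F) uncoloured ab)
      ... | inj₂ (inj₂ (i , _ , shifted)) = lookup F (suc i) , pivot (suc i) , sym shifted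

      shift-inherits-at-vEnd : ∀ {y} → x ≢ y →
        (∀ (i : Fin k) → InE G (lookup F (inject₁ i)) x y →
           (φ (lookup F (suc i)) ≢ just α) × (φ (lookup F (suc i)) ≢ just β)) →
        InheritsABColoursAt (Shift G φ F) φ α β y
      shift-inherits-at-vEnd {y} x≢y notAB {f} yf ab with shift-cases F f
      ... | inj₁ unchanged = f , yf , sym unchanged
      ... | inj₂ (inj₁ uncoloured) = ⊥-elim (uncoloured⇒¬InAB (Shift G φ F) uncoloured ab)
      ... | inj₂ (inj₂ (i , refl , shifted))
        with notAB i (∈V-both⇒InE (pivot (inject₁ i)) yf x≢y)
           | InAB-transport φ (Shift G φ F) (sym shifted) ab
      ...   | ≢α , _ | inj₁ ≡α = ⊥-elim (≢α ≡α)
      ...   | _ , ≢β | inj₂ ≡β = ⊥-elim (≢β ≡β)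

fact2p7 : (G : Multigraph) (r : ℕ) (φ : Coloring G r) (α β : Fin r)
    (k : ℕ) (F : Vec (Edge G) (suc k)) (x y : Vertex G)
    → Proper G φ
    → IsFan G F x y
    → Shiftable G φ F
    → (∀ (i : Fin k) → InE G (lookup F (inject₁ i)) x y
         → (φ (lookup F (suc i)) ≢ just α) × (φ (lookup F (suc i)) ≢ just β))
    → (HopefulFan G φ α β F x y → HopefulEdge G (Shift G φ F) α β (End G F))
      × (SuccessfulFan G φ α β F x y → SuccessfulEdge G (Shift G φ F) α β (End G F))
fact2p7 G r φ α β k F x y _ ((distinct , _) , pivot , end-xy) (_ , ψ-proper) notAB =
  hopeful , successful
  where
    ψ : Coloring G r
    ψ = Shift G φ F

    hopeful : HopefulFan G φ α β F x y → HopefulEdge G ψ α β (End G F)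
    hopeful (_ , _ , deg-x , deg-y) =
      shift-last G φ F distinct ,
      InE-ends G swap end-xy
        ( deg<2-inherit G ψ-proper (shift-inherits-at-pivot G φ F pivot) deg-x
        , deg<2-inherit G ψ-proper
            (shift-inherits-at-vEnd G φ F pivot (InE⇒≢ G end-xy) notAB) deg-y)

    successful : SuccessfulFan G φ α β F x y → SuccessfulEdge G ψ α β (End G F)
    successful (hopeful-F , unrelated) =
      hopeful hopeful-F , unrelated ∘ InE-ends⁻ G (related-sym G ψ) end-xy
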